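{- Let $n\ge3$ be an odd integer. A cardioidal starter of order $n$ exists if and only if $n\in\overline{C_2}$.
   Context: $C_2$ is the set of (odd) primes $p$ such that the multiplicative order of $2$ modulo $p$ is $\equiv2\pmod4$; $\overline{C_2}$ is the set of all products of one or more (not necessarily distinct) primes from $C_2$. A starter of order $n$ ($n$ odd) is a partition of $\mathbb{Z}_n\setminus\{0\}$ into $(n-1)/2$ pairs $\{s_i,t_i\}$ such that the elements $\pm(s_i-t_i)$ are exactly the non-zero elements of $\mathbb{Z}_n$. A starter is cardioidal if every pair has the form $\{i,2i\bmod n\}$ for some $i\in\mathbb{Z}_n\setminus\{0\}$. -}

module Defs where

open import Data.Nat using (ℕ; zero; suc; _+_; _*_; _∸_; _^_; _≤_; _<_; NonZero)
open import Data.Nat.DivMod using (_%_)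
open import Data.Nat.Divisibility using (_∣_)
open import Data.Nat.Primality using (Prime)
open import Data.List using (List; []; _∷_; map; upTo; concatMap)
open import Data.Nat.ListAction using (product)
open import Data.List.Relation.Unary.All using (All)
open import Data.List.Relation.Binary.Permutation.Propositional using (_↭_)
open import Data.Product using (_×_; _,_; Σ; ∃)
open import Data.Sum using (_⊎_)
open import Relation.Binary.PropositionalEquality using (_≡_; _≢_)
open import Relation.Nullary using (¬_)

IsOrderOf2 : ℕ → ℕ → Set
IsOrderOf2 p k = (0 < k) × (p ∣ (2 ^ k ∸ 1)) × (∀ j → 0 < j → j < k → ¬ (p ∣ (2 ^ j ∸ 1)))

InC2 : ℕ → Set
InC2 p = Prime p × (p % 2 ≡ 1) × ∃ λ k → IsOrderOf2 p k × (k % 4 ≡ 2)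

InC2bar : ℕ → Set
InC2bar n = Σ (List ℕ) λ ps → (ps ≢ []) × All InC2 ps × (product ps ≡ n)

nonzeroElems : ℕ → List ℕ
nonzeroElems n = map suc (upTo (n ∸ 1))

-- a pair {s,t} is represented as (s , t); both coordinates are residues in 1..n-1
pairElems : List (ℕ × ℕ) → List ℕ
pairElems = concatMap (λ { (s , t) → s ∷ t ∷ [] })

pairDiffs : (n : ℕ) → .{{NonZero n}} → List (ℕ × ℕ) → List ℕ
pairDiffs n = concatMap (λ { (s , t) → ((s + n ∸ t) % n) ∷ ((t + n ∸ s) % n) ∷ [] })

IsStarter : (n : ℕ) → .{{NonZero n}} → List (ℕ × ℕ) → Set
IsStarter n S = (pairElems S ↭ nonzeroElems n) × (pairDiffs n S ↭ nonzeroElems n)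

IsCardioidal : (n : ℕ) → .{{NonZero n}} → List (ℕ × ℕ) → Set
IsCardioidal n S = All (λ { (s , t) → (t ≡ (2 * s) % n) ⊎ (s ≡ (2 * t) % n) }) S

-- A cardioidal starter is a list of pairs {s, 2s}, whose differences are ±s. So its list I of
-- first coordinates must satisfy I ⊎ 2I = ℤₙ∖{0} = I ⊎ (−I); equivalently, the coloring
-- "x ∈ I" of ℤₙ∖{0} is flipped both by doubling and by negation.
-- Given such a coloring and a prime p ∣ n, write n = qp and L = ord_p(2). Then 2^L q = q in ℤₙ,
-- so L is even; and p ∣ 2^(L/2) + 1 gives 2^(L/2) q = −q, so L/2 is odd.
-- Conversely, ord_p(2) ≡ 2 (mod 4) means p ∣ 2^h + 1 with h odd, and the lifting
-- "A ∣ x + 1 and B ∣ x + 1 with B odd imply AB ∣ x^B + 1" turns this into n ∣ 2^m + 1 with m odd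
-- for every n ∈ C̄₂. Then −x = 2^m x, and x is colored by comparing the largest elements of the
-- orbits of x and 2x under multiplication by 4: the orbit of 4x is that of x, and the two orbits
-- differ because no odd power of 2 fixes x.

module Submission where

open import Defs
open import Data.Bool using (Bool; true; false; not; T)
open import Data.Bool.Properties using (not-¬; not-involutive)
open import Data.Empty using (⊥)
open import Data.Fin using (toℕ; fromℕ<)
open import Data.Fin.Properties using (pigeonhole; toℕ-fromℕ<)
open import Data.List using (List; []; _∷_; _++_; map; upTo; filter)
open import Data.List.Extrema.Nat using (max; argmax-sel; max-mono-⊆; xs≤max)
open import Data.List.Membership.Propositional using (_∈_; _∉_)
open import Data.List.Membership.Propositional.Properties
  using (∈-++⁺ˡ; ∈-++⁺ʳ; ∈-++⁻; ∈-map⁺; ∈-map⁻; ∈-filter⁺; ∈-filter⁻; ∈-upTo⁺; ∈-upTo⁻)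
open import Data.List.Membership.Propositional.Properties.WithK using (unique∧set⇒bag)
open import Data.List.Relation.Binary.BagAndSetEquality using (∼bag⇒↭)
open import Data.List.Relation.Binary.Permutation.Propositional
  using (_↭_; ↭-refl; ↭-sym; ↭-trans; ↭-prep; ↭-swap; ↭⇒↭ₛ)
open import Data.List.Relation.Binary.Permutation.Propositional.Properties using (∈-resp-↭; shift)
import Data.List.Relation.Binary.Permutation.Setoid.Properties as PermutationSetoid
open import Data.List.Relation.Binary.Subset.Propositional using (_⊆_)
open import Data.List.Relation.Unary.All as All using (All; []; _∷_)
open import Data.List.Relation.Unary.Any using (here; there)
open import Data.List.Relation.Unary.Unique.Propositional using (Unique; []; _∷_)
import Data.List.Relation.Unary.Unique.Propositional.Properties as Unique
open import Data.Nat using (ℕ; zero; suc; _+_; _*_; _∸_; _^_; _<_; _≤_; _<?_; z≤n; s≤s; NonZero; >-nonZero; nonTrivial⇒n>1)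
open import Data.Nat.Coprimality using (Coprime; coprime-divisor; coprime-+; 1-coprimeTo)
open import Data.Nat.DivMod
open import Data.Nat.Divisibility
open import Data.Nat.Induction using (<-rec)
open import Data.Nat.ListAction using (product)
open import Data.Nat.ListAction.Properties using (∈⇒∣product)
open import Data.Nat.Primality using (Prime; euclidsLemma; prime⇒nonTrivial)
open import Data.Nat.Primality.Factorisation using (PrimeFactorisation; factorise; module PrimeFactorisation)
open import Data.Nat.Properties
open import Data.Nat.Solver using (module +-*-Solver)
open import Data.Product using (Σ; _×_; _,_; Σ-syntax; ∃-syntax; proj₁; proj₂)
open import Data.Sum using (inj₁; inj₂)
open import Data.Unit using (tt)
open import Function using (id)
open import Function.Bundles using (_⇔_; mk⇔)
open import Relation.Binary.Definitions using (DecidableEquality; tri<; tri≈; tri>)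
open import Relation.Binary.PropositionalEquality
open import Relation.Binary.PropositionalEquality.Properties using (setoid)
open import Relation.Nullary using (¬_; Dec; contradiction)
open import Relation.Nullary.Decidable using (yes; no; does; T?; _×-dec_; dec-true; dec-false)
open import Relation.Unary using (Decidable)

open +-*-Solver using (solve; _:+_; _:*_; _:=_; con)

module _ {a} {A : Set a} where

  Unique-resp-↭ : ∀ {xs ys : List A} → xs ↭ ys → Unique xs → Unique ys
  Unique-resp-↭ p = PermutationSetoid.Unique-resp-↭ (setoid A) (↭⇒↭ₛ p)

  ↭-prep-shift : ∀ {x y : A} {zs xs ys} → zs ↭ xs ++ ys → x ∷ y ∷ zs ↭ x ∷ xs ++ y ∷ ys
  ↭-prep-shift {x} {y} {xs = xs} {ys} zs↭ = ↭-prep x (↭-trans (↭-prep y zs↭) (↭-sym (shift y xs ys)))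

  unique∧set⇒↭ : ∀ {xs ys : List A} → Unique xs → Unique ys → (∀ {z} → z ∈ xs ⇔ z ∈ ys) → xs ↭ ys
  unique∧set⇒↭ xs! ys! xs≈ys = ∼bag⇒↭ (unique∧set⇒bag xs! ys! xs≈ys)

  unique-++⇒disjoint : ∀ xs {ys : List A} {z} → Unique (xs ++ ys) → z ∈ xs → z ∉ ys
  unique-++⇒disjoint (x ∷ xs) (x∉ ∷ _) (here refl) z∈ys = All.lookup x∉ (∈-++⁺ʳ xs z∈ys) refl
  unique-++⇒disjoint (x ∷ xs) (_ ∷ xs!) (there z∈xs) = unique-++⇒disjoint xs xs! z∈xs

  unique-map⁺ : ∀ {b} {B : Set b} {f : A → B} {xs} → (∀ {x y} → x ∈ xs → y ∈ xs → f x ≡ f y → x ≡ y) →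
                Unique xs → Unique (map f xs)
  unique-map⁺ {xs = []} f-inj [] = []
  unique-map⁺ {f = f} {xs = x ∷ xs} f-inj (x∉ ∷ xs!) =
    All.tabulate fx∉ ∷ unique-map⁺ (λ x∈ y∈ → f-inj (there x∈) (there y∈)) xs!
    where
    fx∉ : ∀ {z} → z ∈ map f xs → f x ≢ z
    fx∉ z∈ fx≡z with ∈-map⁻ f z∈
    ... | y , y∈ , refl = All.lookup x∉ y∈ (f-inj (here refl) (there y∈) fx≡z)

Alternates : ∀ {a} {A : Set a} → List A → (A → A) → (A → Bool) → Set a
Alternates U f col = ∀ {x} → x ∈ U → col (f x) ≡ not (col x)

module Halving {a} {A : Set a} (_≟_ : DecidableEquality A) {U : List A} (U! : Unique U)
  {f : A → A} (f-∈ : ∀ {x} → x ∈ U → f x ∈ U)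
  (f-inj : ∀ {x y} → x ∈ U → y ∈ U → f x ≡ f y → x ≡ y) where

  open import Data.List.Membership.DecPropositional _≟_ using (_∈?_)

  split⇒alternates : ∀ {I} → I ++ map f I ↭ U → Alternates U f (λ x → does (x ∈? I))
  split⇒alternates {I} I+fI↭U {x} x∈U with x ∈? I | f x ∈? I
  ... | yes x∈I | yes fx∈I = contradiction (∈-map⁺ f x∈I) (unique-++⇒disjoint I I+fI! fx∈I)
    where
    I+fI! : Unique (I ++ map f I)
    I+fI! = Unique-resp-↭ (↭-sym I+fI↭U) U!
  ... | yes _ | no _ = refl
  ... | no _ | yes _ = refl
  ... | no x∉I | no fx∉I with ∈-++⁻ I (∈-resp-↭ (↭-sym I+fI↭U) (f-∈ x∈U))
  ...   | inj₁ fx∈I = contradiction fx∈I fx∉I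
  ...   | inj₂ fx∈fI with ∈-map⁻ f fx∈fI
  ...     | y , y∈I , fx≡fy = contradiction (subst (_∈ I) (sym x≡y) y∈I) x∉I
    where
    x≡y : x ≡ y
    x≡y = f-inj x∈U (∈-resp-↭ I+fI↭U (∈-++⁺ˡ y∈I)) fx≡fy

  alternates⇒split : (∀ {y} → y ∈ U → ∃[ x ] x ∈ U × f x ≡ y) →
                     ∀ {col} → Alternates U f col →
                     filter (λ x → T? (col x)) U ++ map f (filter (λ x → T? (col x)) U) ↭ U
  alternates⇒split f-surj {col} alt = unique∧set⇒↭ I+fI! U! (mk⇔ ⊆U U⊆)
    where
    P? : ∀ x → Dec (T (col x))
    P? x = T? (col x)

    I : List A
    I = filter P? U

    ∈I⁻ : ∀ {x} → x ∈ I → x ∈ U × T (col x)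
    ∈I⁻ = ∈-filter⁻ P? {xs = U}

    I⊆U : ∀ {x} → x ∈ I → x ∈ U
    I⊆U x∈I = proj₁ (∈I⁻ x∈I)

    T-not-exclusive : ∀ {b c} → c ≡ not b → T b → T c → ⊥
    T-not-exclusive {true} refl _ ()
    T-not-exclusive {false} refl ()

    T-not-exhaustive : ∀ {b c} → c ≡ not b → ¬ T c → T b
    T-not-exhaustive {true} _ _ = tt
    T-not-exhaustive {false} refl ¬Tc = ¬Tc tt

    I+fI! : Unique (I ++ map f I)
    I+fI! = Unique.++⁺ (Unique.filter⁺ P? U!)
      (unique-map⁺ (λ x∈ y∈ → f-inj (I⊆U x∈) (I⊆U y∈)) (Unique.filter⁺ P? U!))
      (λ { (z∈I , z∈fI) → disjoint z∈I z∈fI })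
      where
      disjoint : ∀ {z} → z ∈ I → z ∈ map f I → ⊥
      disjoint z∈I z∈fI with ∈-map⁻ f z∈fI
      ... | y , y∈I , refl = T-not-exclusive (alt (I⊆U y∈I)) (proj₂ (∈I⁻ y∈I)) (proj₂ (∈I⁻ z∈I))

    ⊆U : ∀ {z} → z ∈ I ++ map f I → z ∈ U
    ⊆U z∈ with ∈-++⁻ I z∈
    ... | inj₁ z∈I = I⊆U z∈I
    ... | inj₂ z∈fI with ∈-map⁻ f z∈fI
    ...   | y , y∈I , refl = f-∈ (I⊆U y∈I)

    U⊆ : ∀ {z} → z ∈ U → z ∈ I ++ map f I
    U⊆ {z} z∈U with T? (col z)
    ... | yes Tz = ∈-++⁺ˡ (∈-filter⁺ P? z∈U Tz)
    ... | no ¬Tz with f-surj z∈U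
    ...   | x , x∈U , refl = ∈-++⁺ʳ I (∈-map⁺ f (∈-filter⁺ P? x∈U (T-not-exhaustive (alt x∈U) ¬Tz)))

data Parity : ℕ → Set where
  even : ∀ i → Parity (2 * i)
  odd  : ∀ i → Parity (1 + 2 * i)

parity : ∀ m → Parity m
parity zero = even 0
parity (suc zero) = odd 0
parity (suc (suc m)) with parity m
... | even i = subst Parity (*-suc 2 i) (even (suc i))
... | odd i = subst Parity (cong suc (*-suc 2 i)) (odd (suc i))

2∤1+2*k : ∀ k → ¬ 2 ∣ 1 + 2 * k
2∤1+2*k k 2∣ = contradiction (∣1⇒≡1 (∣m+n∣m⇒∣n (subst (2 ∣_) (+-comm 1 (2 * k)) 2∣) (m∣m*n k))) λ ()

∣1+2*k⇒odd : ∀ {d} k → d ∣ 1 + 2 * k → ∃[ l ] d ≡ 1 + 2 * l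
∣1+2*k⇒odd {d} k d∣ with parity d
... | even i = contradiction (∣-trans (m∣m*n i) d∣) (2∤1+2*k k)
... | odd i = i , refl

odd*odd : ∀ i j → ∃[ l ] (1 + 2 * i) * (1 + 2 * j) ≡ 1 + 2 * l
odd*odd i j = i + j + 2 * i * j ,
  solve 2 (λ i j → (con 1 :+ con 2 :* i) :* (con 1 :+ con 2 :* j) := con 1 :+ con 2 :* (i :+ j :+ con 2 :* i :* j)) refl i j

%2≡1⇒odd : ∀ {n} → n % 2 ≡ 1 → ∃[ k ] n ≡ 1 + 2 * k
%2≡1⇒odd {n} n%2≡1 with parity n
... | even i = contradiction (trans (sym (subst (λ m → m % 2 ≡ 0) (*-comm i 2) (m*n%n≡0 i 2))) n%2≡1) λ ()
... | odd i = i , refl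

odd⇒%2≡1 : ∀ l → (1 + 2 * l) % 2 ≡ 1
odd⇒%2≡1 l = subst (λ m → (1 + m) % 2 ≡ 1) (*-comm l 2) ([m+kn]%n≡m%n 1 l 2)

2*odd%4≡2 : ∀ i → 2 * (1 + 2 * i) % 4 ≡ 2
2*odd%4≡2 i = trans (cong (_% 4) (solve 1 (λ i → con 2 :* (con 1 :+ con 2 :* i) := con 2 :+ i :* con 4) refl i))
                    ([m+kn]%n≡m%n 2 i 4)

odd-coprime-2 : ∀ l → Coprime (1 + 2 * l) 2
odd-coprime-2 zero = 1-coprimeTo 2
odd-coprime-2 (suc l) = subst (λ m → Coprime m 2) (cong suc (sym (*-suc 2 l))) (coprime-+ (odd-coprime-2 l))

<?-flip : ∀ {a b} → a ≢ b → does (b <? a) ≡ not (does (a <? b))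
<?-flip {a} {b} a≢b with <-cmp a b
... | tri< a<b _ _ = trans (dec-false (b <? a) (<⇒≯ a<b)) (cong not (sym (dec-true (a <? b) a<b)))
... | tri≈ _ a≡b _ = contradiction a≡b a≢b
... | tri> _ _ b<a = trans (dec-true (b <? a) b<a) (cong not (sym (dec-false (a <? b) (<⇒≯ b<a))))

module _ (d : ℕ) .{{_ : NonZero d}} where

  [m+n%d]%d≡[m+n]%d : ∀ m n → (m + n % d) % d ≡ (m + n) % d
  [m+n%d]%d≡[m+n]%d m n = begin
    (m + n % d) % d           ≡⟨ %-distribˡ-+ m (n % d) d ⟩
    (m % d + n % d % d) % d   ≡⟨ cong (λ r → (m % d + r) % d) (m%n%n≡m%n n d) ⟩
    (m % d + n % d) % d       ≡⟨ %-distribˡ-+ m n d ⟨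
    (m + n) % d               ∎
    where open ≡-Reasoning

  [m*[n%d]]%d≡[m*n]%d : ∀ m n → (m * (n % d)) % d ≡ (m * n) % d
  [m*[n%d]]%d≡[m*n]%d m n = begin
    (m * (n % d)) % d         ≡⟨ %-distribˡ-* m (n % d) d ⟩
    (m % d * (n % d % d)) % d ≡⟨ cong (λ r → (m % d * r) % d) (m%n%n≡m%n n d) ⟩
    (m % d * (n % d)) % d     ≡⟨ %-distribˡ-* m n d ⟨
    (m * n) % d               ∎
    where open ≡-Reasoning

  m%d≡n%d⇒d∣m∸n : ∀ m n → m % d ≡ n % d → d ∣ m ∸ n
  m%d≡n%d⇒d∣m∸n m n eq = divides (m / d ∸ n / d) (begin
    m ∸ n                                 ≡⟨ cong₂ _∸_ (m≡m%n+[m/n]*n m d) (m≡m%n+[m/n]*n n d) ⟩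
    (m % d + m / d * d) ∸ (n % d + n / d * d) ≡⟨ cong (λ r → (m % d + m / d * d) ∸ (r + n / d * d)) eq ⟨
    (m % d + m / d * d) ∸ (m % d + n / d * d) ≡⟨ [m+n]∸[m+o]≡n∸o (m % d) _ _ ⟩
    m / d * d ∸ n / d * d                 ≡⟨ *-distribʳ-∸ d (m / d) (n / d) ⟨
    (m / d ∸ n / d) * d                   ∎)
    where open ≡-Reasoning

  d∣m∸n⇒m%d≡n%d : ∀ {m n} → n ≤ m → d ∣ m ∸ n → m % d ≡ n % d
  d∣m∸n⇒m%d≡n%d {m} {n} n≤m d∣ = begin
    m % d             ≡⟨ cong (_% d) (m+[n∸m]≡n n≤m) ⟨
    (n + (m ∸ n)) % d ≡⟨ %-remove-+ʳ n d∣ ⟩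
    n % d             ∎
    where open ≡-Reasoning

  %-cancelˡ-+ : ∀ o m n → (o + m) % d ≡ (o + n) % d → m % d ≡ n % d
  %-cancelˡ-+ o m n eq with ≤-total n m
  ... | inj₁ n≤m = d∣m∸n⇒m%d≡n%d n≤m (subst (d ∣_) ([m+n]∸[m+o]≡n∸o o m n) (m%d≡n%d⇒d∣m∸n _ _ eq))
  ... | inj₂ m≤n = sym (d∣m∸n⇒m%d≡n%d m≤n (subst (d ∣_) ([m+n]∸[m+o]≡n∸o o n m) (m%d≡n%d⇒d∣m∸n _ _ (sym eq))))

  [m+d∸n]%d≡o : ∀ {m n o} → n ≤ m + d → o < d → (n + o) % d ≡ m % d → (m + d ∸ n) % d ≡ o
  [m+d∸n]%d≡o {m} {n} {o} n≤m+d o<d eq = begin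
    (m + d ∸ n) % d ≡⟨ %-cancelˡ-+ n (m + d ∸ n) o (begin
        (n + (m + d ∸ n)) % d ≡⟨ cong (_% d) (m+[n∸m]≡n n≤m+d) ⟩
        (m + d) % d           ≡⟨ [m+n]%n≡m%n m d ⟩
        m % d                 ≡⟨ eq ⟨
        (n + o) % d           ∎) ⟩
    o % d           ≡⟨ m<n⇒m%n≡m o<d ⟩
    o               ∎
    where open ≡-Reasoning

m*m∸1≡[m∸1]*[m+1] : ∀ m → m * m ∸ 1 ≡ (m ∸ 1) * (m + 1)
m*m∸1≡[m∸1]*[m+1] zero = refl
m*m∸1≡[m∸1]*[m+1] (suc b) = solve 1 (λ b → b :+ b :* (con 1 :+ b) := b :* ((con 1 :+ b) :+ con 1)) refl b

2^[2*h]∸1≡[2^h∸1]*[2^h+1] : ∀ h → 2 ^ (2 * h) ∸ 1 ≡ (2 ^ h ∸ 1) * (2 ^ h + 1)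
2^[2*h]∸1≡[2^h∸1]*[2^h+1] h = begin
  2 ^ (2 * h) ∸ 1       ≡⟨ cong (λ e → 2 ^ (h + e) ∸ 1) (+-identityʳ h) ⟩
  2 ^ (h + h) ∸ 1       ≡⟨ cong (_∸ 1) (^-distribˡ-+-* 2 h h) ⟩
  2 ^ h * 2 ^ h ∸ 1     ≡⟨ m*m∸1≡[m∸1]*[m+1] (2 ^ h) ⟩
  (2 ^ h ∸ 1) * (2 ^ h + 1) ∎
  where open ≡-Reasoning

least-witness : ∀ {P : ℕ → Set} → Decidable P → ∀ {k} → P k → ∃[ m ] P m × (∀ j → j < m → ¬ P j)
least-witness {P} P? {k} = <-rec (λ k → P k → LeastWitness) step k
  where
  LeastWitness : Set
  LeastWitness = ∃[ m ] P m × (∀ j → j < m → ¬ P j)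
  step : ∀ k → (∀ {j} → j < k → P j → LeastWitness) → P k → LeastWitness
  step k rec Pk with anyUpTo? P? k
  ... | yes (j , j<k , Pj) = rec j<k Pj
  ... | no ¬∃ = k , Pk , λ j j<k Pj → ¬∃ (j , j<k , Pj)

coprime-2^i*y⇒∣y : ∀ {p} → Coprime p 2 → ∀ i {y} → p ∣ 2 ^ i * y → p ∣ y
coprime-2^i*y⇒∣y {p} c zero {y} p∣ = subst (p ∣_) (+-identityʳ y) p∣
coprime-2^i*y⇒∣y {p} c (suc i) {y} p∣ =
  coprime-2^i*y⇒∣y c i (coprime-divisor c (subst (p ∣_) (*-assoc 2 (2 ^ i) y) p∣))

2^d≡1-for-some-d : ∀ p .{{_ : NonZero p}} → Coprime p 2 → ∃[ d ] 0 < d × p ∣ 2 ^ d ∸ 1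
2^d≡1-for-some-d p c with pigeonhole (n<1+n p) (λ j → fromℕ< (m%n<n (2 ^ toℕ j) p))
... | i , j , i<j , eq = d , m<n⇒0<n∸m i<j , coprime-2^i*y⇒∣y c (toℕ i) p∣
  where
  d : ℕ
  d = toℕ j ∸ toℕ i
  2^j%p≡2^i%p : 2 ^ toℕ j % p ≡ 2 ^ toℕ i % p
  2^j%p≡2^i%p = sym (begin
    2 ^ toℕ i % p                         ≡⟨ toℕ-fromℕ< _ ⟨
    toℕ (fromℕ< (m%n<n (2 ^ toℕ i) p))   ≡⟨ cong toℕ eq ⟩
    toℕ (fromℕ< (m%n<n (2 ^ toℕ j) p))   ≡⟨ toℕ-fromℕ< _ ⟩
    2 ^ toℕ j % p                         ∎)
    where open ≡-Reasoning
  2^j∸2^i≡2^i*[2^d∸1] : 2 ^ toℕ j ∸ 2 ^ toℕ i ≡ 2 ^ toℕ i * (2 ^ d ∸ 1)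
  2^j∸2^i≡2^i*[2^d∸1] = begin
    2 ^ toℕ j ∸ 2 ^ toℕ i                 ≡⟨ cong (λ e → 2 ^ e ∸ 2 ^ toℕ i) (m+[n∸m]≡n (<⇒≤ i<j)) ⟨
    2 ^ (toℕ i + d) ∸ 2 ^ toℕ i           ≡⟨ cong₂ _∸_ (^-distribˡ-+-* 2 (toℕ i) d) (sym (*-identityʳ (2 ^ toℕ i))) ⟩
    2 ^ toℕ i * 2 ^ d ∸ 2 ^ toℕ i * 1     ≡⟨ *-distribˡ-∸ (2 ^ toℕ i) (2 ^ d) 1 ⟨
    2 ^ toℕ i * (2 ^ d ∸ 1)               ∎
    where open ≡-Reasoning
  p∣ : p ∣ 2 ^ toℕ i * (2 ^ d ∸ 1)
  p∣ = subst (p ∣_) 2^j∸2^i≡2^i*[2^d∸1] (m%d≡n%d⇒d∣m∸n p _ _ 2^j%p≡2^i%p)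

order-of-2-exists : ∀ p .{{_ : NonZero p}} → Coprime p 2 → ∃[ L ] IsOrderOf2 p L
order-of-2-exists p c with 2^d≡1-for-some-d p c
... | d , 0<d , p∣ with least-witness (λ j → (0 <? j) ×-dec (p ∣? (2 ^ j ∸ 1))) (0<d , p∣)
...   | L , (0<L , p∣L) , minimal = L , 0<L , p∣L , λ j 0<j j<L p∣j → minimal j j<L (0<j , p∣j)

order-2*h⇒∣2^h+1 : ∀ {p h} → Prime p → IsOrderOf2 p (2 * h) → p ∣ 2 ^ h + 1
order-2*h⇒∣2^h+1 {p} {h} pp (0<2h , p∣ , minimal)
  with euclidsLemma (2 ^ h ∸ 1) (2 ^ h + 1) pp (subst (p ∣_) (2^[2*h]∸1≡[2^h∸1]*[2^h+1] h) p∣)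
... | inj₂ p∣2^h+1 = p∣2^h+1
... | inj₁ p∣2^h∸1 = contradiction p∣2^h∸1 (minimal h 0<h h<2h)
  where
  0<h : 0 < h
  0<h = n≢0⇒n>0 λ { refl → <-irrefl refl 0<2h }
  h<2h : h < 2 * h
  h<2h = subst (h <_) (cong (h +_) (sym (+-identityʳ h))) (m<m+n h 0<h)

infix 4 _≡_modulo_

-- Stated without truncated subtraction, so that the expansions below are semiring identities.
_≡_modulo_ : ℕ → ℕ → ℕ → Set
_≡_modulo_ a b m = ∃[ V ] ∃[ W ] a + m * V ≡ b + m * W

≡-modulo-∣ : ∀ {a b m d} → a ≡ b modulo m → d ∣ m → d ∣ b → d ∣ a
≡-modulo-∣ {a} {b} {m} {d} (V , W , eq) d∣m d∣b =
  ∣m+n∣m⇒∣n (subst (d ∣_) (trans (sym eq) (+-comm a (m * V))) (∣m∣n⇒∣m+n d∣b (∣m⇒∣m*n W d∣m))) (∣m⇒∣m*n V d∣m)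

x^k+1-step : ∀ x k → x ^ k + 1 ≡ k * (x + 1) modulo (x + 1) * (x + 1) →
             x ^ (2 + k) + 1 ≡ (2 + k) * (x + 1) modulo (x + 1) * (x + 1)
x^k+1-step x k (V , W , eq) = x * x * V + 1 + 2 * k , k * (x + 1) + x * x * W ,
  +-cancelʳ-≡ (x * x) _ _ (begin
    x ^ (2 + k) + 1 + t * t * (x * x * V + 1 + 2 * k) + x * x
      ≡⟨ solve 4 (λ x X V k →
           x :* (x :* X) :+ con 1 :+ (x :+ con 1) :* (x :+ con 1) :* (x :* x :* V :+ con 1 :+ con 2 :* k) :+ x :* x
           := x :* x :* (X :+ con 1 :+ (x :+ con 1) :* (x :+ con 1) :* V) :+ con 1 :+ (x :+ con 1) :* (x :+ con 1) :* (con 1 :+ con 2 :* k))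
           refl x (x ^ k) V k ⟩
    x * x * (x ^ k + 1 + t * t * V) + 1 + t * t * (1 + 2 * k)
      ≡⟨ cong (λ e → x * x * e + 1 + t * t * (1 + 2 * k)) eq ⟩
    x * x * (k * t + t * t * W) + 1 + t * t * (1 + 2 * k)
      ≡⟨ solve 3 (λ x W k →
           x :* x :* (k :* (x :+ con 1) :+ (x :+ con 1) :* (x :+ con 1) :* W) :+ con 1 :+ (x :+ con 1) :* (x :+ con 1) :* (con 1 :+ con 2 :* k)
           := (con 2 :+ k) :* (x :+ con 1) :+ (x :+ con 1) :* (x :+ con 1) :* (k :* (x :+ con 1) :+ x :* x :* W) :+ x :* x)
           refl x W k ⟩
    (2 + k) * t + t * t * (k * t + x * x * W) + x * x ∎)
  where
  open ≡-Reasoning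
  t : ℕ
  t = x + 1

x^odd+1≡odd*[x+1] : ∀ x i → x ^ (1 + 2 * i) + 1 ≡ (1 + 2 * i) * (x + 1) modulo (x + 1) * (x + 1)
x^odd+1≡odd*[x+1] x zero = 0 , 0 ,
  solve 1 (λ x → x :* con 1 :+ con 1 :+ (x :+ con 1) :* (x :+ con 1) :* con 0
               := con 1 :* (x :+ con 1) :+ (x :+ con 1) :* (x :+ con 1) :* con 0) refl x
x^odd+1≡odd*[x+1] x (suc i) = subst (λ k → x ^ k + 1 ≡ k * (x + 1) modulo (x + 1) * (x + 1))
  (cong suc (sym (*-suc 2 i))) (x^k+1-step x (1 + 2 * i) (x^odd+1≡odd*[x+1] x i))

x+1∣x^odd+1 : ∀ x i → x + 1 ∣ x ^ (1 + 2 * i) + 1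
x+1∣x^odd+1 x i = ≡-modulo-∣ (x^odd+1≡odd*[x+1] x i) (m∣m*n (x + 1)) (n∣m*n (1 + 2 * i))

∣x+1⇒*odd∣x^odd+1 : ∀ {A} x i → A ∣ x + 1 → 1 + 2 * i ∣ x + 1 → A * (1 + 2 * i) ∣ x ^ (1 + 2 * i) + 1
∣x+1⇒*odd∣x^odd+1 {A} x i A∣ k∣ = ≡-modulo-∣ (x^odd+1≡odd*[x+1] x i)
  (*-pres-∣ A∣ k∣) (subst (A * (1 + 2 * i) ∣_) (*-comm (x + 1) _) (*-monoˡ-∣ (1 + 2 * i) A∣))

Divides2^odd+1 : ℕ → Set
Divides2^odd+1 n = ∃[ i ] n ∣ 2 ^ (1 + 2 * i) + 1

*-Divides2^odd+1 : ∀ {A B} → Divides2^odd+1 A → Divides2^odd+1 B → Divides2^odd+1 (A * B)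
*-Divides2^odd+1 {A} {B} (i , A∣) (j , B∣)
  with ∣1+2*k⇒odd (2 ^ (2 * j)) (subst (B ∣_) (+-comm _ 1) B∣)
... | l , refl with odd*odd i j
...   | ab , a*b≡ with odd*odd ab l
...     | e , ab*B≡ = e , subst (λ r → A * B ∣ 2 ^ r + 1) ab*B≡ A*B∣
  where
  a b : ℕ
  a = 1 + 2 * i
  b = 1 + 2 * j
  A∣2^ab+1 : A ∣ 2 ^ (a * b) + 1
  A∣2^ab+1 = ∣-trans A∣ (subst (λ y → 2 ^ a + 1 ∣ y + 1) (^-*-assoc 2 a b) (x+1∣x^odd+1 (2 ^ a) j))
  B∣2^ab+1 : B ∣ 2 ^ (a * b) + 1
  B∣2^ab+1 = ∣-trans B∣ (subst (λ y → 2 ^ b + 1 ∣ y + 1) (trans (^-*-assoc 2 b a) (cong (2 ^_) (*-comm b a)))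
                        (x+1∣x^odd+1 (2 ^ b) i))
  A*B∣ : A * B ∣ 2 ^ ((1 + 2 * ab) * B) + 1
  A*B∣ = subst (λ r → A * B ∣ r + 1) (trans (cong (λ r → (2 ^ r) ^ B) a*b≡) (^-*-assoc 2 (1 + 2 * ab) B))
           (∣x+1⇒*odd∣x^odd+1 (2 ^ (a * b)) l A∣2^ab+1 B∣2^ab+1)

product-Divides2^odd+1 : ∀ {ps} → All Divides2^odd+1 ps → Divides2^odd+1 (product ps)
product-Divides2^odd+1 [] = 0 , 1∣ 3
product-Divides2^odd+1 (p∣ ∷ ps∣) = *-Divides2^odd+1 p∣ (product-Divides2^odd+1 ps∣)

InC2⇒Divides2^odd+1 : ∀ {p} → InC2 p → Divides2^odd+1 p
InC2⇒Divides2^odd+1 {p} (pp , _ , L , ord , L%4≡2) = L / 4 , order-2*h⇒∣2^h+1 pp (subst (IsOrderOf2 p) L≡ ord)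
  where
  L≡ : L ≡ 2 * (1 + 2 * (L / 4))
  L≡ = trans (m≡m%n+[m/n]*n L 4) (trans (cong (_+ L / 4 * 4) L%4≡2)
         (solve 1 (λ q → con 2 :+ q :* con 4 := con 2 :* (con 1 :+ con 2 :* q)) refl (L / 4)))

InC2bar⇒Divides2^odd+1 : ∀ {n} → InC2bar n → Divides2^odd+1 n
InC2bar⇒Divides2^odd+1 (ps , _ , ps∈C2 , refl) = product-Divides2^odd+1 (All.map InC2⇒Divides2^odd+1 ps∈C2)

∈-nonzeroElems⁻ : ∀ {n x} → x ∈ nonzeroElems n → 0 < x × x < n
∈-nonzeroElems⁻ {suc n} x∈ with ∈-map⁻ suc x∈
... | y , y∈ , refl = s≤s z≤n , s≤s (∈-upTo⁻ y∈)

∈-nonzeroElems⁺ : ∀ {n x} → 0 < x → x < n → x ∈ nonzeroElems n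
∈-nonzeroElems⁺ {suc n} {suc x} _ (s≤s x<n) = ∈-map⁺ suc (∈-upTo⁺ x<n)

nonzeroElems-unique : ∀ n → Unique (nonzeroElems n)
nonzeroElems-unique n = Unique.map⁺ suc-injective (Unique.upTo⁺ (n ∸ 1))

module OddModulus (k : ℕ) where

  n : ℕ
  n = 1 + 2 * k

  U : List ℕ
  U = nonzeroElems n

  double half negate : ℕ → ℕ
  double x = 2 * x % n
  half x = (1 + k) * x % n
  negate x = n ∸ x

  double^ : ℕ → ℕ → ℕ
  double^ r x = 2 ^ r * x % n

  [1+n]*x%n≡x : ∀ {x} → x < n → (1 + n) * x % n ≡ x
  [1+n]*x%n≡x {x} x<n = trans (%-remove-+ʳ x (m∣m*n x)) (m<n⇒m%n≡m x<n)

  2*[1+k]≡1+n : 2 * (1 + k) ≡ 1 + n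
  2*[1+k]≡1+n = *-suc 2 k

  half-double : ∀ {x} → x < n → half (double x) ≡ x
  half-double {x} x<n = begin
    (1 + k) * (2 * x % n) % n ≡⟨ [m*[n%d]]%d≡[m*n]%d n (1 + k) (2 * x) ⟩
    (1 + k) * (2 * x) % n     ≡⟨ cong (_% n) (trans (sym (*-assoc (1 + k) 2 x))
                                               (cong (_* x) (trans (*-comm (1 + k) 2) 2*[1+k]≡1+n))) ⟩
    (1 + n) * x % n           ≡⟨ [1+n]*x%n≡x x<n ⟩
    x                         ∎
    where open ≡-Reasoning

  double-half : ∀ {x} → x < n → double (half x) ≡ x
  double-half {x} x<n = begin
    2 * ((1 + k) * x % n) % n ≡⟨ [m*[n%d]]%d≡[m*n]%d n 2 ((1 + k) * x) ⟩
    2 * ((1 + k) * x) % n     ≡⟨ cong (_% n) (trans (sym (*-assoc 2 (1 + k) x)) (cong (_* x) 2*[1+k]≡1+n)) ⟩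
    (1 + n) * x % n           ≡⟨ [1+n]*x%n≡x x<n ⟩
    x                         ∎
    where open ≡-Reasoning

  ∈U⁻ : ∀ {x} → x ∈ U → 0 < x × x < n
  ∈U⁻ = ∈-nonzeroElems⁻

  ∈U⁺ : ∀ {x} → 0 < x → x < n → x ∈ U
  ∈U⁺ = ∈-nonzeroElems⁺

  ∈U⇒< : ∀ {x} → x ∈ U → x < n
  ∈U⇒< x∈U = proj₂ (∈U⁻ x∈U)

  double-∈U : ∀ {x} → x ∈ U → double x ∈ U
  double-∈U {x} x∈U = ∈U⁺ (n≢0⇒n>0 double≢0) (m%n<n (2 * x) n)
    where
    double≢0 : double x ≢ 0
    double≢0 eq = <⇒≢ (proj₁ (∈U⁻ x∈U))
      (trans (cong (_% n) (sym (*-zeroʳ (1 + k)))) (trans (cong half (sym eq)) (half-double (∈U⇒< x∈U))))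

  half-∈U : ∀ {x} → x ∈ U → half x ∈ U
  half-∈U {x} x∈U = ∈U⁺ (n≢0⇒n>0 half≢0) (m%n<n ((1 + k) * x) n)
    where
    half≢0 : half x ≢ 0
    half≢0 eq = <⇒≢ (proj₁ (∈U⁻ x∈U)) (trans (cong double (sym eq)) (double-half (∈U⇒< x∈U)))

  negate-∈U : ∀ {x} → x ∈ U → negate x ∈ U
  negate-∈U x∈U with ∈U⁻ x∈U
  ... | 0<x , x<n = ∈U⁺ (m<n⇒0<n∸m x<n) (∸-monoʳ-< 0<x (<⇒≤ x<n))

  negate-involutive : ∀ {x} → x ∈ U → negate (negate x) ≡ x
  negate-involutive x∈U = m∸[m∸n]≡n (<⇒≤ (∈U⇒< x∈U))

  negate-≢ : ∀ {x} → x ∈ U → negate x ≢ x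
  negate-≢ {x} x∈U eq = 2∤1+2*k k (divides x (begin
    1 + 2 * k       ≡⟨ m∸n+n≡m (<⇒≤ (∈U⇒< x∈U)) ⟨
    n ∸ x + x       ≡⟨ cong (_+ x) eq ⟩
    x + x           ≡⟨ cong (x +_) (+-identityʳ x) ⟨
    2 * x           ≡⟨ *-comm 2 x ⟩
    x * 2           ∎))
    where open ≡-Reasoning

  double-injective : ∀ {x y} → x ∈ U → y ∈ U → double x ≡ double y → x ≡ y
  double-injective x∈U y∈U eq =
    trans (sym (half-double (∈U⇒< x∈U))) (trans (cong half eq) (half-double (∈U⇒< y∈U)))

  double-surjective : ∀ {y} → y ∈ U → ∃[ x ] x ∈ U × double x ≡ y
  double-surjective {y} y∈U = half y , half-∈U y∈U , double-half (∈U⇒< y∈U)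

  negate-injective : ∀ {x y} → x ∈ U → y ∈ U → negate x ≡ negate y → x ≡ y
  negate-injective x∈U y∈U eq =
    trans (sym (negate-involutive x∈U)) (trans (cong negate eq) (negate-involutive y∈U))

  negate-surjective : ∀ {y} → y ∈ U → ∃[ x ] x ∈ U × negate x ≡ y
  negate-surjective {y} y∈U = negate y , negate-∈U y∈U , negate-involutive y∈U

  double^-< : ∀ r x → double^ r x < n
  double^-< r x = m%n<n (2 ^ r * x) n

  double^-zero : ∀ {x} → x < n → double^ 0 x ≡ x
  double^-zero {x} x<n = trans (cong (_% n) (+-identityʳ x)) (m<n⇒m%n≡m x<n)

  double^-+ : ∀ r s x → double^ (r + s) x ≡ double^ r (double^ s x)
  double^-+ r s x = begin
    2 ^ (r + s) * x % n         ≡⟨ cong (λ y → y * x % n) (^-distribˡ-+-* 2 r s) ⟩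
    2 ^ r * 2 ^ s * x % n       ≡⟨ cong (_% n) (*-assoc (2 ^ r) (2 ^ s) x) ⟩
    2 ^ r * (2 ^ s * x) % n     ≡⟨ [m*[n%d]]%d≡[m*n]%d n (2 ^ r) (2 ^ s * x) ⟨
    2 ^ r * (2 ^ s * x % n) % n ∎
    where open ≡-Reasoning

  double^-∈U : ∀ r {x} → x ∈ U → double^ r x ∈ U
  double^-∈U zero x∈U = subst (_∈ U) (sym (double^-zero (∈U⇒< x∈U))) x∈U
  double^-∈U (suc r) {x} x∈U = subst (_∈ U) (sym (double^-+ 1 r x)) (double-∈U (double^-∈U r x∈U))

  double^-2*suc : ∀ a x → double^ (2 * suc a) x ≡ double^ (2 * a) (double^ 2 x)
  double^-2*suc a x = trans (cong (λ r → double^ r x) (trans (*-suc 2 a) (+-comm 2 (2 * a)))) (double^-+ (2 * a) 2 x)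

  double^-periodic : ∀ r {x} → x < n → n ∣ (2 ^ r ∸ 1) * x → double^ r x ≡ x
  double^-periodic r {x} x<n n∣ = begin
    2 ^ r * x % n               ≡⟨ cong (λ y → y * x % n) (m+[n∸m]≡n (m^n>0 2 r)) ⟨
    (x + (2 ^ r ∸ 1) * x) % n   ≡⟨ %-remove-+ʳ x n∣ ⟩
    x % n                       ≡⟨ m<n⇒m%n≡m x<n ⟩
    x                           ∎
    where open ≡-Reasoning

  double^-antiperiodic : ∀ r {x} → x ∈ U → n ∣ (2 ^ r + 1) * x → double^ r x ≡ negate x
  double^-antiperiodic r {x} x∈U n∣ = begin
    double^ r x         ≡⟨ m<n⇒m%n≡m (double^-< r x) ⟨
    double^ r x % n     ≡⟨ %-cancelˡ-+ n x _ _ (begin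
      (x + double^ r x) % n       ≡⟨ [m+n%d]%d≡[m+n]%d n x (2 ^ r * x) ⟩
      (x + 2 ^ r * x) % n         ≡⟨ cong (_% n) (+-comm x (2 ^ r * x)) ⟩
      (2 ^ r * x + x) % n         ≡⟨ cong (λ y → (2 ^ r * x + y) % n) (*-identityˡ x) ⟨
      (2 ^ r * x + 1 * x) % n     ≡⟨ cong (_% n) (*-distribʳ-+ x (2 ^ r) 1) ⟨
      (2 ^ r + 1) * x % n         ≡⟨ n∣m⇒m%n≡0 _ n n∣ ⟩
      0                           ≡⟨ n%n≡0 n ⟨
      n % n                       ≡⟨ cong (_% n) (m+[n∸m]≡n (<⇒≤ (∈U⇒< x∈U))) ⟨
      (x + negate x) % n          ∎) ⟩
    negate x % n        ≡⟨ m<n⇒m%n≡m (∈U⇒< (negate-∈U x∈U)) ⟩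
    negate x            ∎
    where open ≡-Reasoning

  double^-iterate : ∀ e {x} → x < n → double^ e x ≡ x → ∀ j → double^ (j * e) x ≡ x
  double^-iterate e x<n eq zero = double^-zero x<n
  double^-iterate e {x} x<n eq (suc j) = begin
    double^ (e + j * e) x         ≡⟨ double^-+ e (j * e) x ⟩
    double^ e (double^ (j * e) x) ≡⟨ cong (double^ e) (double^-iterate e x<n eq j) ⟩
    double^ e x                   ≡⟨ eq ⟩
    x                             ∎
    where open ≡-Reasoning

  double^-odd-fixed⇒⊥ : ∀ {j x} → n ∣ 2 ^ (1 + 2 * j) + 1 → x ∈ U → ∀ c → double^ (1 + 2 * c) x ≢ x
  double^-odd-fixed⇒⊥ {j} {x} n∣ x∈U c fixed = negate-≢ x∈U (begin
    negate x          ≡⟨ double^-antiperiodic (m * e) x∈U (∣m⇒∣m*n x n∣2^[m*e]+1) ⟨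
    double^ (m * e) x ≡⟨ double^-iterate e (∈U⇒< x∈U) fixed m ⟩
    x                 ∎)
    where
    open ≡-Reasoning
    m e : ℕ
    m = 1 + 2 * j
    e = 1 + 2 * c
    n∣2^[m*e]+1 : n ∣ 2 ^ (m * e) + 1
    n∣2^[m*e]+1 = ∣-trans n∣ (subst (λ y → 2 ^ m + 1 ∣ y + 1) (^-*-assoc 2 m e) (x+1∣x^odd+1 (2 ^ m) c))

  module _ {col : ℕ → Bool} (alt : Alternates U double col) where

    alternates-double^-even : ∀ i {x} → x ∈ U → col (double^ (2 * i) x) ≡ col x
    alternates-double^-odd : ∀ i {x} → x ∈ U → col (double^ (1 + 2 * i) x) ≡ not (col x)

    alternates-double^-even zero x∈U = cong col (double^-zero (∈U⇒< x∈U))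
    alternates-double^-even (suc i) {x} x∈U = begin
      col (double^ (2 * suc i) x)              ≡⟨ cong (λ r → col (double^ r x)) (*-suc 2 i) ⟩
      col (double^ (1 + (1 + 2 * i)) x)        ≡⟨ cong col (double^-+ 1 (1 + 2 * i) x) ⟩
      col (double (double^ (1 + 2 * i) x))     ≡⟨ alt (double^-∈U (1 + 2 * i) x∈U) ⟩
      not (col (double^ (1 + 2 * i) x))        ≡⟨ cong not (alternates-double^-odd i x∈U) ⟩
      not (not (col x))                        ≡⟨ not-involutive (col x) ⟩
      col x                                    ∎
      where open ≡-Reasoning

    alternates-double^-odd i {x} x∈U = begin
      col (double^ (1 + 2 * i) x)   ≡⟨ cong col (double^-+ 1 (2 * i) x) ⟩
      col (double (double^ (2 * i) x)) ≡⟨ alt (double^-∈U (2 * i) x∈U) ⟩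
      not (col (double^ (2 * i) x)) ≡⟨ cong not (alternates-double^-even i x∈U) ⟩
      not (col x)                   ∎
      where open ≡-Reasoning

  Coloring : Set
  Coloring = Σ[ col ∈ (ℕ → Bool) ] Alternates U double col × Alternates U negate col

  pairs : List ℕ → List (ℕ × ℕ)
  pairs = map (λ s → s , double s)

  pairs-cardioidal : ∀ I → IsCardioidal n (pairs I)
  pairs-cardioidal [] = []
  pairs-cardioidal (s ∷ I) = inj₁ refl ∷ pairs-cardioidal I

  pairElems-pairs : ∀ I → pairElems (pairs I) ↭ I ++ map double I
  pairElems-pairs [] = ↭-refl
  pairElems-pairs (s ∷ I) = ↭-prep-shift (pairElems-pairs I)

  pairDiff-negate : ∀ {s} → s ∈ U → (s + n ∸ double s) % n ≡ negate s
  pairDiff-negate {s} s∈U =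
    [m+d∸n]%d≡o n (≤-trans (<⇒≤ (m%n<n (2 * s) n)) (m≤n+m n s)) (∈U⇒< (negate-∈U s∈U)) (begin
    (double s + (n ∸ s)) % n  ≡⟨ cong (_% n) (+-comm (double s) (n ∸ s)) ⟩
    (n ∸ s + double s) % n    ≡⟨ [m+n%d]%d≡[m+n]%d n (n ∸ s) (2 * s) ⟩
    (n ∸ s + 2 * s) % n       ≡⟨ cong (_% n) (n∸s+2*s≡s+n (<⇒≤ (∈U⇒< s∈U))) ⟩
    (s + n) % n               ≡⟨ [m+n]%n≡m%n s n ⟩
    s % n                     ∎)
    where
    open ≡-Reasoning
    n∸s+2*s≡s+n : s ≤ n → n ∸ s + 2 * s ≡ s + n
    n∸s+2*s≡s+n s≤n = begin
      n ∸ s + (s + (s + 0)) ≡⟨ cong (λ y → n ∸ s + (s + y)) (+-identityʳ s) ⟩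
      n ∸ s + (s + s)       ≡⟨ +-assoc (n ∸ s) s s ⟨
      n ∸ s + s + s         ≡⟨ cong (_+ s) (m∸n+n≡m s≤n) ⟩
      n + s                 ≡⟨ +-comm n s ⟩
      s + n                 ∎

  pairDiff-id : ∀ {s} → s ∈ U → (double s + n ∸ s) % n ≡ s
  pairDiff-id {s} s∈U = [m+d∸n]%d≡o n (≤-trans (<⇒≤ (∈U⇒< s∈U)) (m≤n+m n (double s))) (∈U⇒< s∈U) (begin
    (s + s) % n           ≡⟨ cong (λ y → (s + y) % n) (+-identityʳ s) ⟨
    2 * s % n             ≡⟨ m%n%n≡m%n (2 * s) n ⟨
    double s % n          ∎)
    where open ≡-Reasoning

  pairDiffs-pairs : ∀ {I} → All (_∈ U) I → pairDiffs n (pairs I) ↭ I ++ map negate I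
  pairDiffs-pairs [] = ↭-refl
  pairDiffs-pairs {s ∷ I} (s∈U ∷ I⊆U) rewrite pairDiff-negate s∈U | pairDiff-id s∈U =
    ↭-trans (↭-swap (negate s) s ↭-refl) (↭-prep-shift (pairDiffs-pairs I⊆U))

  cardioidal⇒pairs : ∀ {S} → IsCardioidal n S →
    ∃[ I ] pairElems S ↭ pairElems (pairs I) × pairDiffs n S ↭ pairDiffs n (pairs I)
  cardioidal⇒pairs [] = [] , ↭-refl , ↭-refl
  cardioidal⇒pairs {(s , _) ∷ _} (inj₁ refl ∷ card) with cardioidal⇒pairs card
  ... | I , elems , diffs = s ∷ I , ↭-prep _ (↭-prep _ elems) , ↭-prep _ (↭-prep _ diffs)
  cardioidal⇒pairs {(_ , t) ∷ _} (inj₂ refl ∷ card) with cardioidal⇒pairs card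
  ... | I , elems , diffs = t ∷ I , ↭-swap _ _ elems , ↭-swap _ _ diffs

  module ByDouble = Halving _≟_ (nonzeroElems-unique n) double-∈U double-injective
  module ByNegate = Halving _≟_ (nonzeroElems-unique n) negate-∈U negate-injective

  starter⇒coloring : ∀ {S} → IsStarter n S → IsCardioidal n S → Coloring
  starter⇒coloring (elems↭U , diffs↭U) card with cardioidal⇒pairs card
  ... | I , elems , diffs = _ , ByDouble.split⇒alternates {I} I+2I↭U , ByNegate.split⇒alternates {I} I−I↭U
    where
    I+2I↭U : I ++ map double I ↭ U
    I+2I↭U = ↭-trans (↭-sym (pairElems-pairs I)) (↭-trans (↭-sym elems) elems↭U)
    I−I↭U : I ++ map negate I ↭ U
    I−I↭U = ↭-trans (↭-sym (pairDiffs-pairs {I} (All.tabulate (λ x∈I → ∈-resp-↭ I+2I↭U (∈-++⁺ˡ x∈I)))))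
              (↭-trans (↭-sym diffs) diffs↭U)

  coloring⇒starter : Coloring → Σ[ S ∈ List (ℕ × ℕ) ] IsStarter n S × IsCardioidal n S
  coloring⇒starter (col , alt-double , alt-negate) =
    pairs I , (↭-trans (pairElems-pairs I) (ByDouble.alternates⇒split double-surjective alt-double) ,
               ↭-trans (pairDiffs-pairs I⊆U) (ByNegate.alternates⇒split negate-surjective alt-negate)) ,
    pairs-cardioidal I
    where
    I : List ℕ
    I = filter (λ x → T? (col x)) U
    I⊆U : All (_∈ U) I
    I⊆U = All.tabulate (λ x∈I → proj₁ (∈-filter⁻ (λ x → T? (col x)) {xs = U} x∈I))

  coloring⇒prime∣n⇒InC2 : Coloring → ∀ {p} → Prime p → p ∣ n → InC2 p
  coloring⇒prime∣n⇒InC2 (col , alt-double , alt-negate) {p} pp p∣n@(divides q n≡q*p) with ∣1+2*k⇒odd k p∣n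
  ... | l , refl with order-of-2-exists p (odd-coprime-2 l)
  ...   | L , ord = pp , odd⇒%2≡1 l , L , ord , order%4≡2 L ord
    where
    0<q : 0 < q
    0<q = n≢0⇒n>0 λ { refl → 0≢1+n (sym n≡q*p) }
    q∈U : q ∈ U
    q∈U = ∈U⁺ 0<q (subst (q <_) (sym n≡q*p) (m<m*n q p {{>-nonZero 0<q}} (nonTrivial⇒n>1 p {{prime⇒nonTrivial pp}})))

    n∣*q : ∀ {y} → p ∣ y → n ∣ y * q
    n∣*q {y} p∣y = subst (_∣ y * q) (trans (*-comm p q) (sym n≡q*p)) (*-monoˡ-∣ q p∣y)

    not-alternating : col q ≢ not (col q)
    not-alternating = not-¬ refl

    order%4≡2 : ∀ L → IsOrderOf2 p L → L % 4 ≡ 2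
    order%4≡2 L ord@(_ , p∣2^L∸1 , _) with parity L
    ... | odd i = contradiction (begin
      col q               ≡⟨ cong col (double^-periodic (1 + 2 * i) (∈U⇒< q∈U) (n∣*q p∣2^L∸1)) ⟨
      col (double^ L q)   ≡⟨ alternates-double^-odd alt-double i q∈U ⟩
      not (col q)         ∎) not-alternating
      where open ≡-Reasoning
    ... | even h with parity h | double^-antiperiodic h q∈U (n∣*q (order-2*h⇒∣2^h+1 {h = h} pp ord))
    ...   | odd i | _ = 2*odd%4≡2 i
    ...   | even i | double^h≡negate = contradiction (begin
      col q                   ≡⟨ alternates-double^-even alt-double i q∈U ⟨
      col (double^ (2 * i) q) ≡⟨ cong col double^h≡negate ⟩
      col (negate q)          ≡⟨ alt-negate q∈U ⟩
      not (col q)             ∎) not-alternating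
      where open ≡-Reasoning

  coloring⇒InC2bar : 1 < n → Coloring → InC2bar n
  coloring⇒InC2bar 1<n c = factors , factors≢[] ,
    All.tabulate (λ p∈ → coloring⇒prime∣n⇒InC2 c (All.lookup factorsPrime p∈) (∈factors⇒∣n p∈)) ,
    sym isFactorisation
    where
    F : PrimeFactorisation n
    F = factorise n
    open PrimeFactorisation F
    ∈factors⇒∣n : ∀ {p} → p ∈ factors → p ∣ n
    ∈factors⇒∣n p∈ = subst (_ ∣_) (sym isFactorisation) (∈⇒∣product p∈)
    factors≢[] : factors ≢ []
    factors≢[] eq = <⇒≢ 1<n (sym (trans isFactorisation (cong product eq)))

  module OrbitColoring (j : ℕ) (n∣2^m+1 : n ∣ 2 ^ (1 + 2 * j) + 1) where

    m : ℕ
    m = 1 + 2 * j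

    double^m≡negate : ∀ {x} → x ∈ U → double^ m x ≡ negate x
    double^m≡negate {x} x∈U = double^-antiperiodic m x∈U (∣m⇒∣m*n x n∣2^m+1)

    double^2m≡id : ∀ {x} → x < n → double^ (2 * m) x ≡ x
    double^2m≡id {x} x<n = double^-periodic (2 * m) x<n (∣m⇒∣m*n x
      (subst (n ∣_) (sym (2^[2*h]∸1≡[2^h∸1]*[2^h+1] m)) (∣n⇒∣m*n (2 ^ m ∸ 1) n∣2^m+1)))

    orbit : ℕ → List ℕ
    orbit x = map (λ a → double^ (2 * a) x) (upTo m)

    ∈-orbit : ∀ c x → double^ (2 * c) x ∈ orbit x
    ∈-orbit c x = subst (_∈ orbit x) (begin
      double^ r x                              ≡⟨ double^-iterate (2 * m) (double^-< r x) (double^2m≡id (double^-< r x)) (c / m) ⟨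
      double^ (c / m * (2 * m)) (double^ r x)  ≡⟨ double^-+ (c / m * (2 * m)) r x ⟨
      double^ (c / m * (2 * m) + r) x          ≡⟨ cong (λ e → double^ e x) 2*c≡ ⟩
      double^ (2 * c) x                        ∎) (∈-map⁺ _ (∈-upTo⁺ (m%n<n c m)))
      where
      open ≡-Reasoning
      r : ℕ
      r = 2 * (c % m)
      2*c≡ : c / m * (2 * m) + r ≡ 2 * c
      2*c≡ = trans (solve 3 (λ q m r → q :* (con 2 :* m) :+ con 2 :* r := con 2 :* (r :+ q :* m)) refl (c / m) m (c % m))
                   (cong (2 *_) (sym (m≡m%n+[m/n]*n c m)))

    orbit-double²⊆orbit : ∀ x → orbit (double^ 2 x) ⊆ orbit x
    orbit-double²⊆orbit x y∈ with ∈-map⁻ (λ a → double^ (2 * a) (double^ 2 x)) {xs = upTo m} y∈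
    ... | a , _ , refl = subst (_∈ orbit x) (double^-2*suc a x) (∈-orbit (suc a) x)

    orbit⊆orbit-double² : ∀ x → orbit x ⊆ orbit (double^ 2 x)
    orbit⊆orbit-double² x y∈ with ∈-map⁻ (λ a → double^ (2 * a) x) {xs = upTo m} y∈
    ... | a , _ , refl = subst (_∈ orbit (double^ 2 x)) (begin
      double^ (2 * (a + 2 * j)) (double^ 2 x)   ≡⟨ double^-2*suc (a + 2 * j) x ⟨
      double^ (2 * suc (a + 2 * j)) x           ≡⟨ cong (λ r → double^ r x) (solve 2 (λ a j →
                                                     con 2 :* (con 1 :+ (a :+ con 2 :* j)) := con 2 :* (con 1 :+ con 2 :* j) :+ con 2 :* a) refl a j) ⟩
      double^ (2 * m + 2 * a) x                 ≡⟨ double^-+ (2 * m) (2 * a) x ⟩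
      double^ (2 * m) (double^ (2 * a) x)       ≡⟨ double^2m≡id (double^-< (2 * a) x) ⟩
      double^ (2 * a) x                         ∎) (∈-orbit (a + 2 * j) (double^ 2 x))
      where open ≡-Reasoning

    rep : ℕ → ℕ
    rep x = max 0 (orbit x)

    rep-double² : ∀ x → rep (double^ 2 x) ≡ rep x
    rep-double² x = ≤-antisym (max-mono-⊆ ≤-refl (orbit-double²⊆orbit x)) (max-mono-⊆ ≤-refl (orbit⊆orbit-double² x))

    rep-∈ : ∀ {x} → x ∈ U → ∃[ a ] a < m × rep x ≡ double^ (2 * a) x
    rep-∈ {x} x∈U with argmax-sel id 0 (orbit x)
    ... | inj₂ rep∈ with ∈-map⁻ (λ a → double^ (2 * a) x) {xs = upTo m} rep∈
    ...   | a , a∈ , eq = a , ∈-upTo⁻ a∈ , eq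
    rep-∈ {x} x∈U | inj₁ rep≡0 = contradiction (subst (x ≤_) rep≡0 x≤rep) (<⇒≱ (proj₁ (∈U⁻ x∈U)))
      where
      x≤rep : x ≤ rep x
      x≤rep = All.lookup (xs≤max 0 (orbit x)) (subst (_∈ orbit x) (double^-zero (∈U⇒< x∈U)) (∈-orbit 0 x))

    rep-double-≢ : ∀ {x} → x ∈ U → rep x ≢ rep (double x)
    rep-double-≢ {x} x∈U rep-x≡rep-2x with rep-∈ x∈U | rep-∈ (double-∈U x∈U)
    ... | a , a<m , rep-x≡ | b , _ , rep-2x≡ = double^-odd-fixed⇒⊥ {j} n∣2^m+1 x∈U (m ∸ a + b) (sym (begin
      x                                                ≡⟨ double^2m≡id (∈U⇒< x∈U) ⟨
      double^ (2 * m) x                                ≡⟨ cong (λ r → double^ (2 * r) x) (m∸n+n≡m (<⇒≤ a<m)) ⟨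
      double^ (2 * (m ∸ a + a)) x                      ≡⟨ cong (λ r → double^ r x) (*-distribˡ-+ 2 (m ∸ a) a) ⟩
      double^ (2 * (m ∸ a) + 2 * a) x                  ≡⟨ double^-+ (2 * (m ∸ a)) (2 * a) x ⟩
      double^ (2 * (m ∸ a)) (double^ (2 * a) x)        ≡⟨ cong (double^ (2 * (m ∸ a))) (trans (sym rep-x≡) (trans rep-x≡rep-2x rep-2x≡)) ⟩
      double^ (2 * (m ∸ a)) (double^ (2 * b) (double x)) ≡⟨ cong (double^ (2 * (m ∸ a))) (double^-+ (2 * b) 1 x) ⟨
      double^ (2 * (m ∸ a)) (double^ (2 * b + 1) x)    ≡⟨ double^-+ (2 * (m ∸ a)) (2 * b + 1) x ⟨
      double^ (2 * (m ∸ a) + (2 * b + 1)) x            ≡⟨ cong (λ r → double^ r x) (solve 2 (λ c b →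
                                                            con 2 :* c :+ (con 2 :* b :+ con 1) := con 1 :+ con 2 :* (c :+ b)) refl (m ∸ a) b) ⟩
      double^ (1 + 2 * (m ∸ a + b)) x                  ∎))
      where open ≡-Reasoning

    col : ℕ → Bool
    col x = does (rep x <? rep (double x))

    col-alternates-double : Alternates U double col
    col-alternates-double {x} x∈U = begin
      does (rep (double x) <? rep (double (double x)))  ≡⟨ cong (λ y → does (rep (double x) <? rep y)) (double^-+ 1 1 x) ⟨
      does (rep (double x) <? rep (double^ 2 x))        ≡⟨ cong (λ r → does (rep (double x) <? r)) (rep-double² x) ⟩
      does (rep (double x) <? rep x)                    ≡⟨ <?-flip (rep-double-≢ x∈U) ⟩
      not (col x)                                       ∎
      where open ≡-Reasoning

    col-alternates-negate : Alternates U negate col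
    col-alternates-negate {x} x∈U = trans (cong col (sym (double^m≡negate x∈U)))
                                          (alternates-double^-odd col-alternates-double j x∈U)

    coloring : Coloring
    coloring = col , col-alternates-double , col-alternates-negate

  Divides2^odd+1⇒coloring : Divides2^odd+1 n → Coloring
  Divides2^odd+1⇒coloring (j , n∣) = OrbitColoring.coloring j n∣

theorem5 : (n : ℕ) → .{{_ : NonZero n}} → 3 ≤ n → n % 2 ≡ 1 →
    (Σ (List (ℕ × ℕ)) (λ S → IsStarter n S × IsCardioidal n S)) ⇔ InC2bar n
theorem5 n 3≤n n%2≡1 with %2≡1⇒odd {n} n%2≡1
... | k , refl = mk⇔
  (λ (S , starter , cardioidal) → coloring⇒InC2bar (≤-trans (s≤s (s≤s z≤n)) 3≤n) (starter⇒coloring starter cardioidal))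
  (λ n∈C2bar → coloring⇒starter (Divides2^odd+1⇒coloring (InC2bar⇒Divides2^odd+1 n∈C2bar)))
  where open OddModulus k
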